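{- For all $k,\ell,n\in\mathbb{N}$ there exists a graph $G$ with pathwidth at most $k+1$ such that for any graph $H$ and path $P$, if $G$ is isomorphic to a subgraph of $H\boxtimes P\boxtimes K_\ell$, then $P_n+K_k$ is isomorphic to a subgraph of $H$.
   Context: Graphs are finite and simple; $\mathbb{N}=\{1,2,\dots\}$. $P_n$ is the path on $n$ vertices and $K_k$ the complete graph on $k$ vertices. For graphs $A,B$, the complete join $A+B$ is the disjoint union of $A$ and $B$ together with all edges between $V(A)$ and $V(B)$. The strong product $A\boxtimes B$ has vertex set $V(A)\times V(B)$ with distinct $(v,w),(v',w')$ adjacent if ($v=v'$ or $vv'\in E(A)$) and ($w=w'$ or $ww'\in E(B)$). Pathwidth is the usual minimum width of a path-decomposition. -}

module Defs where

open import Data.Nat using (ℕ; zero; suc; _+_; _*_; _≤_)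
open import Data.Fin using (Fin; toℕ; splitAt; remQuot) renaming (_≤_ to _≤ᶠ_)
open import Data.Fin.Subset using (Subset; _∈_; ∣_∣)
open import Data.Product using (Σ; ∃; ∃-syntax; _×_; _,_; proj₁; proj₂)
open import Data.Sum using (_⊎_; inj₁; inj₂)
open import Data.Empty using (⊥)
open import Relation.Nullary using (¬_)
open import Relation.Binary.PropositionalEquality using (_≡_; refl; sym)
open import Function.Definitions using (Injective)

record Graph : Set₁ where
  field
    size  : ℕ
    Adj   : Fin size → Fin size → Set
    symm  : ∀ {u v} → Adj u v → Adj v u
    irrefl : ∀ {u} → ¬ Adj u u
open Graph public

n≢1+n : ∀ m → ¬ (m ≡ suc m)
n≢1+n zero ()
n≢1+n (suc m) e = n≢1+n m (Data.Nat.Properties.suc-injective e)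
  where import Data.Nat.Properties

PathAdj : ∀ n → Fin n → Fin n → Set
PathAdj n i j = (suc (toℕ i) ≡ toℕ j) ⊎ (suc (toℕ j) ≡ toℕ i)

P : ℕ → Graph
P n = record
  { size = n
  ; Adj = PathAdj n
  ; symm = λ { (inj₁ e) → inj₂ e ; (inj₂ e) → inj₁ e }
  ; irrefl = λ { {u} (inj₁ e) → n≢1+n (toℕ u) (sym e) ; {u} (inj₂ e) → n≢1+n (toℕ u) (sym e) }
  }

K : ℕ → Graph
K k = record
  { size = k
  ; Adj = λ i j → ¬ (i ≡ j)
  ; symm = λ ne e → ne (sym e)
  ; irrefl = λ ne → ne refl
  }

-- Complete join A + B : vertices of A are Fin (size A) embedded first, then B.
module _ (A B : Graph) where
  JoinAdj′ : Fin (size A) ⊎ Fin (size B) → Fin (size A) ⊎ Fin (size B) → Set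
  JoinAdj′ (inj₁ x) (inj₁ y) = Adj A x y
  JoinAdj′ (inj₂ x) (inj₂ y) = Adj B x y
  JoinAdj′ (inj₁ _) (inj₂ _) = Data.Unit.⊤
    where import Data.Unit
  JoinAdj′ (inj₂ _) (inj₁ _) = Data.Unit.⊤
    where import Data.Unit

  JoinAdj′-sym : ∀ x y → JoinAdj′ x y → JoinAdj′ y x
  JoinAdj′-sym (inj₁ x) (inj₁ y) a = symm A a
  JoinAdj′-sym (inj₂ x) (inj₂ y) a = symm B a
  JoinAdj′-sym (inj₁ _) (inj₂ _) a = _
  JoinAdj′-sym (inj₂ _) (inj₁ _) a = _

  JoinAdj′-irr : ∀ x → ¬ JoinAdj′ x x
  JoinAdj′-irr (inj₁ x) = irrefl A
  JoinAdj′-irr (inj₂ x) = irrefl B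

_⊕_ : Graph → Graph → Graph
A ⊕ B = record
  { size = size A + size B
  ; Adj = λ u v → JoinAdj′ A B (splitAt (size A) u) (splitAt (size A) v)
  ; symm = λ {u} {v} → JoinAdj′-sym A B (splitAt (size A) u) (splitAt (size A) v)
  ; irrefl = λ {u} → JoinAdj′-irr A B (splitAt (size A) u)
  }

-- Strong product A ⊠ B : vertex set Fin (size A * size B) ≅ Fin (size A) × Fin (size B)
module _ (A B : Graph) where
  StrongAdj′ : Fin (size A) × Fin (size B) → Fin (size A) × Fin (size B) → Set
  StrongAdj′ (v , w) (v′ , w′) =
    ¬ (v ≡ v′ × w ≡ w′) × (v ≡ v′ ⊎ Adj A v v′) × (w ≡ w′ ⊎ Adj B w w′)

  StrongAdj′-sym : ∀ x y → StrongAdj′ x y → StrongAdj′ y x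
  StrongAdj′-sym (v , w) (v′ , w′) (ne , a , b) =
    (λ { (e₁ , e₂) → ne (sym e₁ , sym e₂) }) , f a , g b
    where
      f : v ≡ v′ ⊎ Adj A v v′ → v′ ≡ v ⊎ Adj A v′ v
      f (inj₁ e) = inj₁ (sym e)
      f (inj₂ x) = inj₂ (symm A x)
      g : w ≡ w′ ⊎ Adj B w w′ → w′ ≡ w ⊎ Adj B w′ w
      g (inj₁ e) = inj₁ (sym e)
      g (inj₂ x) = inj₂ (symm B x)

  StrongAdj′-irr : ∀ x → ¬ StrongAdj′ x x
  StrongAdj′-irr (v , w) (ne , _) = ne (refl , refl)

_⊠_ : Graph → Graph → Graph
A ⊠ B = record
  { size = size A * size B
  ; Adj = λ u v → StrongAdj′ A B (remQuot (size B) u) (remQuot (size B) v)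
  ; symm = λ {u} {v} → StrongAdj′-sym A B (remQuot (size B) u) (remQuot (size B) v)
  ; irrefl = λ {u} → StrongAdj′-irr A B (remQuot (size B) u)
  }

infixl 7 _⊠_
infixl 6 _⊕_

-- G is isomorphic to a (not necessarily induced) subgraph of H:
-- an injective vertex map preserving adjacency.
_⊆ᵍ_ : Graph → Graph → Set
G ⊆ᵍ H = Σ (Fin (size G) → Fin (size H)) λ f →
  Injective _≡_ _≡_ f × (∀ {u v} → Adj G u v → Adj H (f u) (f v))

record PathDecomposition (G : Graph) (w : ℕ) : Set where
  field
    length    : ℕ
    bag       : Fin length → Subset (size G)
    bag-size  : ∀ i → ∣ bag i ∣ ≤ suc w
    vertex-covered : ∀ v → ∃[ i ] (v ∈ bag i)
    edge-covered   : ∀ {u v} → Adj G u v → ∃[ i ] (u ∈ bag i × v ∈ bag i)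
    consecutive    : ∀ v {i j l} → i ≤ᶠ j → j ≤ᶠ l → v ∈ bag i → v ∈ bag l → v ∈ bag j

PathwidthAtMost : Graph → ℕ → Set
PathwidthAtMost G w = PathDecomposition G w

module Submission where

-- G is a tower: a long path at level 0, and at level j + 1 an apex joined to 3ℓ + 1 disjoint
-- copies of level j; an apex raises pathwidth by one and disjoint unions do not raise it.
-- Given G ⊆ H ⊠ P ⊠ K ℓ, project to H.  Everything lies in the closed neighbourhood of the
-- image α of the top apex, which meets each fibre over a vertex of H in at most 3ℓ vertices.
-- So below an apex projecting to h some copy avoids the fibre over h and hence projects into
-- the neighbourhood of h; iterating gives k apices forming a clique, all adjacent to the
-- projection of a path.  That projection is a walk visiting no vertex more than 3ℓ times, and
-- a long enough such walk contains a path on n vertices.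

open import Defs
open import Data.Bool using (true; false)
open import Data.Empty using (⊥; ⊥-elim)
open import Data.Fin as Fin
  using (Fin; zero; suc; toℕ; fromℕ<; inject₁; splitAt; join; remQuot; combine; _↑ˡ_; _↑ʳ_)
  renaming (_≤_ to _≤ᶠ_)
open import Data.Fin.Properties as Finₚ
  using (any?; all?; ¬∀⟶∃¬; toℕ-fromℕ<; toℕ-injective; toℕ-inject₁; toℕ-↑ˡ; toℕ-↑ʳ; toℕ<n; ↑ˡ-injective; ↑ʳ-injective;
         splitAt-↑ˡ; splitAt-↑ʳ; splitAt-join; join-splitAt)
open import Data.Fin.Subset using (Subset; _∈_; ∣_∣; _∪_; ⁅_⁆) renaming (⊥ to ∅)
open import Data.Fin.Subset.Properties using (x∈⁅x⁆; x∈⁅y⁆⇒x≡y; x∈p∪q⁻; x∈p∪q⁺; ∣⁅x⁆∣≡1; ∣⊥∣≡0; ∉⊥)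
open import Data.Nat using (ℕ; zero; suc; _+_; _*_; _≤_; _<_; z≤n; s≤s; NonZero)
open import Data.Nat.DivMod using (_mod_; m<n⇒m%n≡m)
import Data.Nat.Properties as ℕ
open import Data.Product using (Σ; ∃-syntax; _×_; _,_; proj₁; proj₂)
open import Data.Sum using (_⊎_; inj₁; inj₂)
open import Data.Vec using ([]; _∷_)
open import Data.Vec.Functional using () renaming (_∷_ to _∷ᶠ_)
open import Data.Unit using (⊤; tt)
open import Relation.Binary.PropositionalEquality
open import Relation.Nullary using (¬_; Dec; yes; no)
open import Function.Definitions using (Injective)

∣p∪q∣≤∣p∣+∣q∣ : ∀ {n} (p q : Subset n) → ∣ p ∪ q ∣ ≤ ∣ p ∣ + ∣ q ∣
∣p∪q∣≤∣p∣+∣q∣ []          []          = z≤n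
∣p∪q∣≤∣p∣+∣q∣ (true ∷ p)  (true ∷ q)  =
  s≤s (ℕ.≤-trans (∣p∪q∣≤∣p∣+∣q∣ p q) (ℕ.+-monoʳ-≤ ∣ p ∣ (ℕ.n≤1+n _)))
∣p∪q∣≤∣p∣+∣q∣ (true ∷ p)  (false ∷ q) = s≤s (∣p∪q∣≤∣p∣+∣q∣ p q)
∣p∪q∣≤∣p∣+∣q∣ (false ∷ p) (true ∷ q)  =
  ℕ.≤-trans (s≤s (∣p∪q∣≤∣p∣+∣q∣ p q)) (ℕ.≤-reflexive (sym (ℕ.+-suc ∣ p ∣ ∣ q ∣)))
∣p∪q∣≤∣p∣+∣q∣ (false ∷ p) (false ∷ q) = ∣p∪q∣≤∣p∣+∣q∣ p q

image : ∀ {m n} → (Fin m → Fin n) → Subset n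
image {zero}  f = ∅
image {suc m} f = ⁅ f zero ⁆ ∪ image (λ i → f (suc i))

∣image∣≤ : ∀ {m n} (f : Fin m → Fin n) → ∣ image f ∣ ≤ m
∣image∣≤ {zero}  {n} f = ℕ.≤-reflexive (∣⊥∣≡0 n)
∣image∣≤ {suc m} f = ℕ.≤-trans (∣p∪q∣≤∣p∣+∣q∣ ⁅ f zero ⁆ _)
  (subst (λ s → s + ∣ image (λ i → f (suc i)) ∣ ≤ suc m) (sym (∣⁅x⁆∣≡1 (f zero)))
         (s≤s (∣image∣≤ (λ i → f (suc i)))))

∈-image : ∀ {m n} (f : Fin m → Fin n) i → f i ∈ image f
∈-image f zero    = x∈p∪q⁺ (inj₁ (x∈⁅x⁆ (f zero)))
∈-image f (suc i) = x∈p∪q⁺ (inj₂ (∈-image (λ i → f (suc i)) i))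

image⁻ : ∀ {m n} (f : Fin m → Fin n) {x} → x ∈ image f → ∃[ i ] f i ≡ x
image⁻ {zero}  f p = ⊥-elim (∉⊥ p)
image⁻ {suc m} f p with x∈p∪q⁻ ⁅ f zero ⁆ _ p
... | inj₁ q = zero , sym (x∈⁅y⁆⇒x≡y _ q)
... | inj₂ q with image⁻ (λ i → f (suc i)) q
...   | i , e = suc i , e

-- Bags listed with repetitions, so that the width bound holds by construction.
Bag : ℕ → ℕ → Set
Bag w n = Fin (suc w) → Fin n

_∈ᵇ_ : ∀ {w n} → Fin n → Bag w n → Set
v ∈ᵇ b = ∃[ x ] b x ≡ v

record ListedPathDecomposition (G : Graph) (w : ℕ) : Set where
  field
    lastBag        : ℕ
    bag            : Fin (suc lastBag) → Bag w (size G)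
    vertex-covered : ∀ v → ∃[ i ] v ∈ᵇ bag i
    edge-covered   : ∀ {u v} → Adj G u v → ∃[ i ] (u ∈ᵇ bag i × v ∈ᵇ bag i)
    consecutive    : ∀ v {i j l} → i ≤ᶠ j → j ≤ᶠ l → v ∈ᵇ bag i → v ∈ᵇ bag l → v ∈ᵇ bag j

∈ᵇ⇒∈-image : ∀ {w n} {v : Fin n} (b : Bag w n) → v ∈ᵇ b → v ∈ image b
∈ᵇ⇒∈-image b (x , refl) = ∈-image b x

toPathDecomposition : ∀ {G w} → ListedPathDecomposition G w → PathwidthAtMost G w
toPathDecomposition d = record
  { length         = suc lastBag
  ; bag            = λ i → image (bag i)
  ; bag-size       = λ i → ∣image∣≤ (bag i)
  ; vertex-covered = λ v → let i , p = vertex-covered v in i , ∈ᵇ⇒∈-image (bag i) p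
  ; edge-covered   = λ a → let i , p , q = edge-covered a in
                       i , ∈ᵇ⇒∈-image (bag i) p , ∈ᵇ⇒∈-image (bag i) q
  ; consecutive    = λ v {i} {j} {l} i≤j j≤l p q →
                       ∈ᵇ⇒∈-image (bag j) (consecutive v i≤j j≤l (image⁻ (bag i) p) (image⁻ (bag l) q))
  }
  where open ListedPathDecomposition d

module _ {M : ℕ} where

  pathBag : Fin (suc M) → Bag 1 (suc (suc M))
  pathBag t zero    = inject₁ t
  pathBag t (suc _) = suc t

  ∈-pathBag⁻ : ∀ {t v} → v ∈ᵇ pathBag t → toℕ t ≤ toℕ v × toℕ v ≤ suc (toℕ t)
  ∈-pathBag⁻ {t} (zero , refl) =
    ℕ.≤-reflexive (sym (toℕ-inject₁ t)) , ℕ.≤-trans (ℕ.≤-reflexive (toℕ-inject₁ t)) (ℕ.n≤1+n _)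
  ∈-pathBag⁻ (suc _ , refl)    = ℕ.n≤1+n _ , ℕ.≤-refl

  ∈-pathBag⁺ : ∀ {t v} → toℕ t ≤ toℕ v → toℕ v ≤ suc (toℕ t) → v ∈ᵇ pathBag t
  ∈-pathBag⁺ {t} t≤v v≤1+t with ℕ.m≤n⇒m<n∨m≡n t≤v
  ... | inj₁ t<v = suc zero , toℕ-injective (ℕ.≤-antisym t<v v≤1+t)
  ... | inj₂ t≡v = zero , toℕ-injective (trans (toℕ-inject₁ t) t≡v)

  pathDecomposition : ListedPathDecomposition (P (suc (suc M))) 1
  pathDecomposition = record
    { lastBag = M ; bag = pathBag ; vertex-covered = covered ; edge-covered = edge
    ; consecutive = λ v i≤j j≤l p q →
        let i≤v , v≤1+i = ∈-pathBag⁻ p ; l≤v , _ = ∈-pathBag⁻ q in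
        ∈-pathBag⁺ (ℕ.≤-trans j≤l l≤v) (ℕ.≤-trans v≤1+i (s≤s i≤j))
    }
    where
    covered : ∀ v → ∃[ t ] v ∈ᵇ pathBag t
    covered zero    = zero , zero , refl
    covered (suc t) = t , suc zero , refl

    successor : ∀ {u v} → suc (toℕ u) ≡ toℕ v → ∃[ t ] (u ∈ᵇ pathBag t × v ∈ᵇ pathBag t)
    successor {u} {suc t} e =
      t , (zero , toℕ-injective (trans (toℕ-inject₁ t) (ℕ.suc-injective (sym e)))) , (suc zero , refl)

    edge : ∀ {u v} → PathAdj (suc (suc M)) u v → ∃[ t ] (u ∈ᵇ pathBag t × v ∈ᵇ pathBag t)
    edge (inj₁ e) = successor e
    edge (inj₂ e) = let t , p , q = successor e in t , q , p

apexDecomposition : ∀ {A w} → ListedPathDecomposition A w → ListedPathDecomposition (K 1 ⊕ A) (suc w)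
apexDecomposition {A} {w} d = record
  { lastBag = lastBag ; bag = bag′ ; vertex-covered = covered ; edge-covered = edge ; consecutive = consecutive′ }
  where
  open ListedPathDecomposition d

  bag′ : Fin (suc lastBag) → Bag (suc w) (suc (size A))
  bag′ i zero    = zero
  bag′ i (suc x) = suc (bag i x)

  suc-∈ᵇ : ∀ {i v} → v ∈ᵇ bag i → suc v ∈ᵇ bag′ i
  suc-∈ᵇ (x , e) = suc x , cong suc e

  suc-∈ᵇ⁻ : ∀ {i v} → suc v ∈ᵇ bag′ i → v ∈ᵇ bag i
  suc-∈ᵇ⁻ (suc x , e) = x , Finₚ.suc-injective e

  covered : ∀ v → ∃[ i ] v ∈ᵇ bag′ i
  covered zero    = zero , zero , refl
  covered (suc v) = let i , p = vertex-covered v in i , suc-∈ᵇ p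

  edge : ∀ {u v} → Adj (K 1 ⊕ A) u v → ∃[ i ] (u ∈ᵇ bag′ i × v ∈ᵇ bag′ i)
  edge {zero}  {zero}  a = ⊥-elim (a refl)
  edge {zero}  {suc v} _ = let i , p = vertex-covered v in i , (zero , refl) , suc-∈ᵇ p
  edge {suc u} {zero}  _ = let i , p = vertex-covered u in i , suc-∈ᵇ p , (zero , refl)
  edge {suc u} {suc v} a = let i , p , q = edge-covered a in i , suc-∈ᵇ p , suc-∈ᵇ q

  consecutive′ : ∀ v {i j l} → i ≤ᶠ j → j ≤ᶠ l → v ∈ᵇ bag′ i → v ∈ᵇ bag′ l → v ∈ᵇ bag′ j
  consecutive′ zero    _   _   _ _ = zero , refl
  consecutive′ (suc v) i≤j j≤l p q = suc-∈ᵇ (consecutive v i≤j j≤l (suc-∈ᵇ⁻ p) (suc-∈ᵇ⁻ q))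

module _ (A B : Graph) where
  UnionAdj : Fin (size A) ⊎ Fin (size B) → Fin (size A) ⊎ Fin (size B) → Set
  UnionAdj (inj₁ x) (inj₁ y) = Adj A x y
  UnionAdj (inj₂ x) (inj₂ y) = Adj B x y
  UnionAdj (inj₁ _) (inj₂ _) = ⊥
  UnionAdj (inj₂ _) (inj₁ _) = ⊥

  UnionAdj-sym : ∀ x y → UnionAdj x y → UnionAdj y x
  UnionAdj-sym (inj₁ x) (inj₁ y) a = symm A a
  UnionAdj-sym (inj₂ x) (inj₂ y) a = symm B a

  UnionAdj-irrefl : ∀ x → ¬ UnionAdj x x
  UnionAdj-irrefl (inj₁ x) = irrefl A
  UnionAdj-irrefl (inj₂ x) = irrefl B

_⊎ᵍ_ : Graph → Graph → Graph
A ⊎ᵍ B = record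
  { size   = size A + size B
  ; Adj    = λ u v → UnionAdj A B (splitAt (size A) u) (splitAt (size A) v)
  ; symm   = λ {u} {v} → UnionAdj-sym A B (splitAt (size A) u) (splitAt (size A) v)
  ; irrefl = λ {u} → UnionAdj-irrefl A B (splitAt (size A) u)
  }

↑ˡ≢↑ʳ : ∀ {m n} (i : Fin m) (j : Fin n) → ¬ (i ↑ˡ n ≡ m ↑ʳ j)
↑ˡ≢↑ʳ {m} {n} i j e = ℕ.<⇒≱ i<m (subst (m ≤_) (cong toℕ (sym e)) m≤j′)
  where
  i<m : toℕ (i ↑ˡ n) < m
  i<m = subst (_< m) (sym (toℕ-↑ˡ i n)) (toℕ<n i)
  m≤j′ : m ≤ toℕ (m ↑ʳ j)
  m≤j′ = subst (m ≤_) (sym (toℕ-↑ʳ m j)) (ℕ.m≤m+n m (toℕ j))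

unionDecomposition : ∀ {A B w} → ListedPathDecomposition A w → ListedPathDecomposition B w →
                     ListedPathDecomposition (A ⊎ᵍ B) w
unionDecomposition {A} {B} {w} dA dB = record
  { lastBag = a + suc b ; bag = bag ; vertex-covered = vertex-covered
  ; edge-covered = edge-covered ; consecutive = consecutive }
  where
  module A′ = ListedPathDecomposition dA
  module B′ = ListedPathDecomposition dB
  a = A′.lastBag
  b = B′.lastBag
  nA = size A
  nB = size B
  Index = Fin (suc a) ⊎ Fin (suc b)

  bag⊎ : Index → Bag w (nA + nB)
  bag⊎ (inj₁ i) x = A′.bag i x ↑ˡ nB
  bag⊎ (inj₂ i) x = nA ↑ʳ B′.bag i x

  bag : Fin (suc a + suc b) → Bag w (nA + nB)
  bag i = bag⊎ (splitAt (suc a) i)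

  rank : Index → ℕ
  rank s = toℕ (join (suc a) (suc b) s)

  toℕ≡rank : ∀ i → toℕ i ≡ rank (splitAt (suc a) i)
  toℕ≡rank i = cong toℕ (sym (join-splitAt (suc a) (suc b) i))

  relabel : ∀ v t → join nA nB (splitAt nA v) ∈ᵇ bag⊎ t → v ∈ᵇ bag (join (suc a) (suc b) t)
  relabel v t p = subst (λ s → v ∈ᵇ bag⊎ s) (sym (splitAt-join (suc a) (suc b) t))
                        (subst (_∈ᵇ bag⊎ t) (join-splitAt nA nB v) p)

  ↑ˡ-∈ᵇ : ∀ {i u} → u ∈ᵇ A′.bag i → (u ↑ˡ nB) ∈ᵇ bag⊎ (inj₁ i)
  ↑ˡ-∈ᵇ (x , e) = x , cong (_↑ˡ nB) e

  ↑ʳ-∈ᵇ : ∀ {i u} → u ∈ᵇ B′.bag i → (nA ↑ʳ u) ∈ᵇ bag⊎ (inj₂ i)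
  ↑ʳ-∈ᵇ (x , e) = x , cong (nA ↑ʳ_) e

  covered : ∀ s → ∃[ t ] join nA nB s ∈ᵇ bag⊎ t
  covered (inj₁ u) = let i , p = A′.vertex-covered u in inj₁ i , ↑ˡ-∈ᵇ p
  covered (inj₂ u) = let i , p = B′.vertex-covered u in inj₂ i , ↑ʳ-∈ᵇ p

  edge : ∀ s s′ → UnionAdj A B s s′ → ∃[ t ] (join nA nB s ∈ᵇ bag⊎ t × join nA nB s′ ∈ᵇ bag⊎ t)
  edge (inj₁ u) (inj₁ v) e = let i , p , q = A′.edge-covered e in inj₁ i , ↑ˡ-∈ᵇ p , ↑ˡ-∈ᵇ q
  edge (inj₂ u) (inj₂ v) e = let i , p , q = B′.edge-covered e in inj₂ i , ↑ʳ-∈ᵇ p , ↑ʳ-∈ᵇ q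

  left<right : ∀ i j → rank (inj₁ i) < rank (inj₂ j)
  left<right i j = subst₂ _<_ (sym (toℕ-↑ˡ i (suc b))) (sym (toℕ-↑ʳ (suc a) j))
                          (ℕ.≤-trans (toℕ<n i) (ℕ.m≤m+n (suc a) (toℕ j)))

  consecutive⊎ : ∀ v s t u → rank s ≤ rank t → rank t ≤ rank u → v ∈ᵇ bag⊎ s → v ∈ᵇ bag⊎ u → v ∈ᵇ bag⊎ t
  consecutive⊎ _ (inj₁ i) (inj₁ j) (inj₁ l) i≤j j≤l (x , refl) (y , e) =
    ↑ˡ-∈ᵇ (A′.consecutive _ (subst₂ _≤_ (toℕ-↑ˡ i (suc b)) (toℕ-↑ˡ j (suc b)) i≤j)
                              (subst₂ _≤_ (toℕ-↑ˡ j (suc b)) (toℕ-↑ˡ l (suc b)) j≤l)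
                              (x , refl) (y , ↑ˡ-injective nB _ _ e))
  consecutive⊎ _ (inj₂ i) (inj₂ j) (inj₂ l) i≤j j≤l (x , refl) (y , e) =
    ↑ʳ-∈ᵇ (B′.consecutive _ (ℕ.+-cancelˡ-≤ (suc a) _ _ (subst₂ _≤_ (toℕ-↑ʳ (suc a) i) (toℕ-↑ʳ (suc a) j) i≤j))
                              (ℕ.+-cancelˡ-≤ (suc a) _ _ (subst₂ _≤_ (toℕ-↑ʳ (suc a) j) (toℕ-↑ʳ (suc a) l) j≤l))
                              (x , refl) (y , ↑ʳ-injective nA _ _ e))
  consecutive⊎ _ (inj₁ _) _        (inj₂ _) _   _   (x , refl) (y , e) = ⊥-elim (↑ˡ≢↑ʳ _ _ (sym e))
  consecutive⊎ _ (inj₂ _) _        (inj₁ _) _   _   (x , refl) (y , e) = ⊥-elim (↑ˡ≢↑ʳ _ _ e)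
  consecutive⊎ _ (inj₁ _) (inj₂ j) (inj₁ l) _   j≤l _ _ = ⊥-elim (ℕ.<⇒≱ (left<right l j) j≤l)
  consecutive⊎ _ (inj₂ i) (inj₁ j) (inj₂ _) i≤j _   _ _ = ⊥-elim (ℕ.<⇒≱ (left<right j i) i≤j)

  vertex-covered : ∀ v → ∃[ i ] v ∈ᵇ bag i
  vertex-covered v = let t , p = covered (splitAt nA v) in join (suc a) (suc b) t , relabel v t p

  edge-covered : ∀ {u v} → Adj (A ⊎ᵍ B) u v → ∃[ i ] (u ∈ᵇ bag i × v ∈ᵇ bag i)
  edge-covered {u} {v} e = let t , p , q = edge (splitAt nA u) (splitAt nA v) e in
    join (suc a) (suc b) t , relabel u t p , relabel v t q

  consecutive : ∀ v {i j l} → i ≤ᶠ j → j ≤ᶠ l → v ∈ᵇ bag i → v ∈ᵇ bag l → v ∈ᵇ bag j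
  consecutive v {i} {j} {l} i≤j j≤l = consecutive⊎ v (splitAt (suc a) i) (splitAt (suc a) j) (splitAt (suc a) l)
    (subst₂ _≤_ (toℕ≡rank i) (toℕ≡rank j) i≤j) (subst₂ _≤_ (toℕ≡rank j) (toℕ≡rank l) j≤l)

-- Copies C A is the disjoint union of suc C copies of A.
Copies : ℕ → Graph → Graph
Copies zero    A = A
Copies (suc C) A = A ⊎ᵍ Copies C A

copiesDecomposition : ∀ C {A w} → ListedPathDecomposition A w → ListedPathDecomposition (Copies C A) w
copiesDecomposition zero    d = d
copiesDecomposition (suc C) d = unionDecomposition d (copiesDecomposition C d)

Tower : ℕ → ℕ → ℕ → Graph
Tower N C zero    = P (suc (suc N))
Tower N C (suc j) = K 1 ⊕ Copies C (Tower N C j)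

towerDecomposition : ∀ N C j → ListedPathDecomposition (Tower N C j) (suc j)
towerDecomposition N C zero    = pathDecomposition
towerDecomposition N C (suc j) = apexDecomposition (copiesDecomposition C (towerDecomposition N C j))

⊆ᵍ-refl : ∀ {A} → A ⊆ᵍ A
⊆ᵍ-refl = (λ u → u) , (λ e → e) , (λ a → a)

⊆ᵍ-trans : ∀ {A B C} → A ⊆ᵍ B → B ⊆ᵍ C → A ⊆ᵍ C
⊆ᵍ-trans (f , f-inj , f-adj) (g , g-inj , g-adj) =
  (λ u → g (f u)) , (λ e → f-inj (g-inj e)) , (λ a → g-adj (f-adj a))

⊆ᵍ-⊎ᵍˡ : ∀ {A B} → A ⊆ᵍ (A ⊎ᵍ B)
⊆ᵍ-⊎ᵍˡ {A} {B} = (_↑ˡ size B) , ↑ˡ-injective (size B) _ _ ,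
  λ {u} {v} → subst₂ (UnionAdj A B) (sym (splitAt-↑ˡ (size A) u (size B))) (sym (splitAt-↑ˡ (size A) v (size B)))

⊆ᵍ-⊎ᵍʳ : ∀ {A B} → B ⊆ᵍ (A ⊎ᵍ B)
⊆ᵍ-⊎ᵍʳ {A} {B} = (size A ↑ʳ_) , ↑ʳ-injective (size A) _ _ ,
  λ {u} {v} → subst₂ (UnionAdj A B) (sym (splitAt-↑ʳ (size A) (size B) u)) (sym (splitAt-↑ʳ (size A) (size B) v))

⊆ᵍ-⊕ʳ : ∀ {A B} → B ⊆ᵍ (A ⊕ B)
⊆ᵍ-⊕ʳ {A} {B} = (size A ↑ʳ_) , ↑ʳ-injective (size A) _ _ ,
  λ {u} {v} → subst₂ (JoinAdj′ A B) (sym (splitAt-↑ʳ (size A) (size B) u)) (sym (splitAt-↑ʳ (size A) (size B) v))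

copy : ∀ C A → Fin (suc C) → A ⊆ᵍ Copies C A
copy zero    A _       = ⊆ᵍ-refl {A}
copy (suc C) A zero    = ⊆ᵍ-⊎ᵍˡ {A} {Copies C A}
copy (suc C) A (suc i) = ⊆ᵍ-trans {A} {Copies C A} {Copies (suc C) A} (copy C A i) (⊆ᵍ-⊎ᵍʳ {A} {Copies C A})

copies-disjoint : ∀ C A {i j} u v → proj₁ (copy C A i) u ≡ proj₁ (copy C A j) v → i ≡ j
copies-disjoint zero    A {zero}  {zero}  u v e = refl
copies-disjoint (suc C) A {zero}  {zero}  u v e = refl
copies-disjoint (suc C) A {zero}  {suc j} u v e = ⊥-elim (↑ˡ≢↑ʳ _ _ e)
copies-disjoint (suc C) A {suc i} {zero}  u v e = ⊥-elim (↑ˡ≢↑ʳ _ _ (sym e))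
copies-disjoint (suc C) A {suc i} {suc j} u v e = cong suc (copies-disjoint C A u v (↑ʳ-injective (size A) _ _ e))

∷ᶠ-injective : ∀ {A : Set} {n} {a : A} {f : Fin n → A} →
               Injective _≡_ _≡_ f → (∀ i → f i ≢ a) → Injective _≡_ _≡_ (a ∷ᶠ f)
∷ᶠ-injective f-inj f≢a {zero}  {zero}  e = refl
∷ᶠ-injective f-inj f≢a {zero}  {suc j} e = ⊥-elim (f≢a j (sym e))
∷ᶠ-injective f-inj f≢a {suc i} {zero}  e = ⊥-elim (f≢a i e)
∷ᶠ-injective f-inj f≢a {suc i} {suc j} e = cong suc (f-inj e)

-- After its at most c visits to the start vertex, a walk of this length has a stretch of
-- walkLength c n steps avoiding it, which yields the rest of the path recursively.
walkLength : ℕ → ℕ → ℕ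
walkLength c zero    = 1
walkLength c (suc n) = suc (c * suc (walkLength c n))

walkLength-pos : ∀ c n → 1 ≤ walkLength c n
walkLength-pos c zero    = s≤s z≤n
walkLength-pos c (suc n) = s≤s z≤n

module _ (H : Graph) where

  -- The walk w 0, …, w (T - 1); values of w from T on are ignored.
  IsLazyWalk : (ℕ → Fin (size H)) → ℕ → Set
  IsLazyWalk w T = ∀ t → suc t < T → w t ≡ w (suc t) ⊎ Adj H (w t) (w (suc t))

  VisitsAtMost : ℕ → (ℕ → Fin (size H)) → ℕ → Set
  VisitsAtMost c w T =
    ∀ x (ts : Fin (suc c) → ℕ) → Injective _≡_ _≡_ ts → (∀ i → ts i < T) → ¬ (∀ i → w (ts i) ≡ x)

  record PathWithin (S : Fin (size H) → Set) (n : ℕ) : Set where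
    field
      vertex    : Fin (suc n) → Fin (size H)
      within    : ∀ i → S (vertex i)
      injective : Injective _≡_ _≡_ vertex
      adjacent  : ∀ i j → suc (toℕ i) ≡ toℕ j → Adj H (vertex i) (vertex j)

  module _ (w : ℕ → Fin (size H)) (T : ℕ) (x : Fin (size H)) (L : ℕ) where

    AvoidsAfter : ℕ → Set
    AvoidsAfter s = ∀ (i : Fin L) → w (suc (toℕ i + s)) ≢ x

    Visits : ℕ → ℕ → Set
    Visits r s = Σ (Fin r → ℕ) λ ts →
      Injective _≡_ _≡_ ts × (∀ i → ts i < T) × (∀ i → w (ts i) ≡ x) × (∀ i → s ≤ ts i)

    returns-or-avoids : ∀ r s → w s ≡ x → r * suc L + s < T →
                        (∃[ s′ ] (w s′ ≡ x × L + s′ < T × AvoidsAfter s′)) ⊎ Visits (suc r) s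
    returns-or-avoids zero s ws s<T =
      inj₂ ((λ _ → s) , (λ { {zero} {zero} _ → refl }) , (λ _ → s<T) , (λ _ → ws) , (λ _ → ℕ.≤-refl))
    returns-or-avoids (suc r) s ws lt with any? (λ (i : Fin L) → w (suc (toℕ i + s)) Fin.≟ x)
    ... | no never = inj₁ (s , ws , L+s<T , λ i e → never (i , e))
      where
      L+s<T : L + s < T
      L+s<T = ℕ.<-trans (s≤s (ℕ.+-monoˡ-≤ s (ℕ.m≤m+n L (r * suc L)))) lt
    ... | yes (i , wi) with returns-or-avoids r (suc (toℕ i + s)) wi bound
      where
      bound : r * suc L + suc (toℕ i + s) < T
      bound = ℕ.<-trans (s≤s (begin
        r * suc L + suc (toℕ i + s) ≤⟨ ℕ.+-monoʳ-≤ (r * suc L) (ℕ.+-monoˡ-≤ s (toℕ<n i)) ⟩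
        r * suc L + (L + s)         ≡⟨ sym (ℕ.+-assoc (r * suc L) L s) ⟩
        (r * suc L + L) + s         ≡⟨ cong (_+ s) (ℕ.+-comm (r * suc L) L) ⟩
        (L + r * suc L) + s         ∎)) lt
        where open ℕ.≤-Reasoning
    ...   | inj₁ avoids = inj₁ avoids
    ...   | inj₂ (ts , ts-inj , ts<T , wts , later) =
      inj₂ ( s ∷ᶠ ts
           , ∷ᶠ-injective ts-inj (λ j e → ℕ.<-irrefl (sym e) (ℕ.<-≤-trans s<i+s (later j)))
           , (λ { zero → ℕ.≤-<-trans (ℕ.m≤n+m s _) lt ; (suc j) → ts<T j })
           , (λ { zero → ws ; (suc j) → wts j })
           , (λ { zero → ℕ.≤-refl ; (suc j) → ℕ.<⇒≤ (ℕ.<-≤-trans s<i+s (later j)) }))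
      where
      s<i+s : s < suc (toℕ i + s)
      s<i+s = s≤s (ℕ.m≤n+m s (toℕ i))

  lazyWalk-step : ∀ {w T s x} → IsLazyWalk w T → suc s < T → w s ≡ x → w (suc s) ≢ x → Adj H x (w (suc s))
  lazyWalk-step lazy s<T refl moves with lazy _ s<T
  ... | inj₁ stays = ⊥-elim (moves (sym stays))
  ... | inj₂ a     = a

  walk⇒path : ∀ c n (S : Fin (size H) → Set) (w : ℕ → Fin (size H)) T → walkLength c n ≤ T →
              (∀ t → t < T → S (w t)) → IsLazyWalk w T → VisitsAtMost c w T →
              Σ (PathWithin S n) λ p → PathWithin.vertex p zero ≡ w 0
  walk⇒path c zero S w T 1≤T inS _ _ =
    record { vertex = λ _ → w 0 ; within = λ _ → inS 0 1≤T
           ; injective = λ { {zero} {zero} _ → refl } ; adjacent = λ { zero zero () } } , refl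
  walk⇒path c (suc n) S w T len inS lazy visits
    with returns-or-avoids w T (w 0) (walkLength c n) c 0 refl (subst (_< T) (sym (ℕ.+-identityʳ _)) len)
  ... | inj₂ (ts , ts-inj , ts<T , wts , _) = ⊥-elim (visits (w 0) ts ts-inj ts<T wts)
  ... | inj₁ (s , ws , L+s<T , avoids) =
    record { vertex = w 0 ∷ᶠ vertex ; within = within′
           ; injective = ∷ᶠ-injective injective (λ i → proj₂ (within i)) ; adjacent = adjacent′ } , refl
    where
    L = walkLength c n
    w′ : ℕ → Fin (size H)
    w′ t = w (suc (t + s))
    S′ : Fin (size H) → Set
    S′ y = S y × y ≢ w 0
    in-range : ∀ t → t < L → suc (t + s) < T
    in-range t t<L = ℕ.≤-<-trans (ℕ.+-monoˡ-≤ s t<L) L+s<T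
    inS′ : ∀ t → t < L → S′ (w′ t)
    inS′ t t<L = inS _ (in-range t t<L) ,
                 subst (λ u → w (suc (u + s)) ≢ w 0) (toℕ-fromℕ< t<L) (avoids (fromℕ< t<L))
    rest : Σ (PathWithin S′ n) λ p → PathWithin.vertex p zero ≡ w′ 0
    rest = walk⇒path c n S′ w′ L ℕ.≤-refl inS′ (λ t t<L → lazy _ (in-range (suc t) t<L))
             (λ y ts ts-inj ts<L → visits y (λ i → suc (ts i + s))
                (λ e → ts-inj (ℕ.+-cancelʳ-≡ s _ _ (ℕ.suc-injective e))) (λ i → in-range (ts i) (ts<L i)))
    open PathWithin (proj₁ rest)
    within′ : ∀ i → S ((w 0 ∷ᶠ vertex) i)
    within′ zero    = inS 0 (ℕ.≤-trans (s≤s z≤n) len)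
    within′ (suc i) = proj₁ (within i)
    adjacent′ : ∀ i j → suc (toℕ i) ≡ toℕ j → Adj H ((w 0 ∷ᶠ vertex) i) ((w 0 ∷ᶠ vertex) j)
    adjacent′ zero    (suc zero)    _ = subst (Adj H (w 0)) (sym (proj₂ rest))
      (lazyWalk-step lazy (in-range 0 (walkLength-pos c n)) ws (inS′ 0 (walkLength-pos c n) .proj₂))
    adjacent′ (suc i) (suc j)       e = adjacent i j (ℕ.suc-injective e)
    adjacent′ zero    (suc (suc _)) ()
    adjacent′ (suc i) zero          ()

  weaken : ∀ {S S′ : Fin (size H) → Set} {n} → (∀ {y} → S′ y → S y) → PathWithin S′ n → PathWithin S n
  weaken S′⊆S p = record
    { vertex = vertex ; within = λ i → S′⊆S (within i) ; injective = injective ; adjacent = adjacent }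
    where open PathWithin p

  record Fan (S : Fin (size H) → Set) (n j : ℕ) : Set where
    field
      path               : PathWithin S n
      apex               : Fin j → Fin (size H)
      apex-within        : ∀ a → S (apex a)
      apex-clique        : ∀ a b → a ≢ b → Adj H (apex a) (apex b)
      path-apex-adjacent : ∀ i a → Adj H (PathWithin.vertex path i) (apex a)

  pathFan : ∀ {S n} → PathWithin S n → Fan S n 0
  pathFan p = record { path = p ; apex = λ () ; apex-within = λ () ; apex-clique = λ () ; path-apex-adjacent = λ _ () }

  addApex : ∀ {S n j} h → S h → Fan (λ y → S y × Adj H h y) n j → Fan S n (suc j)
  addApex {S} h Sh F = record
    { path = weaken proj₁ path ; apex = h ∷ᶠ apex ; apex-within = apex-within′
    ; apex-clique = apex-clique′ ; path-apex-adjacent = path-apex-adjacent′ }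
    where
    open Fan F
    apex-within′ : ∀ a → S ((h ∷ᶠ apex) a)
    apex-within′ zero    = Sh
    apex-within′ (suc a) = proj₁ (apex-within a)
    apex-clique′ : ∀ a b → a ≢ b → Adj H ((h ∷ᶠ apex) a) ((h ∷ᶠ apex) b)
    apex-clique′ zero    zero    a≢b = ⊥-elim (a≢b refl)
    apex-clique′ zero    (suc b) _   = proj₂ (apex-within b)
    apex-clique′ (suc a) zero    _   = symm H (proj₂ (apex-within a))
    apex-clique′ (suc a) (suc b) a≢b = apex-clique a b (λ e → a≢b (cong suc e))
    path-apex-adjacent′ : ∀ i a → Adj H (PathWithin.vertex path i) ((h ∷ᶠ apex) a)
    path-apex-adjacent′ i zero    = symm H (proj₂ (PathWithin.within path i))
    path-apex-adjacent′ i (suc a) = path-apex-adjacent i a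

  fan⇒⊆ᵍ : ∀ {S n k} → Fan S n k → (P (suc n) ⊕ K k) ⊆ᵍ H
  fan⇒⊆ᵍ {S} {n} {k} F =
    (λ u → g (splitAt (suc n) u)) , g∘splitAt-injective ,
    λ {u} {v} → g-adjacent (splitAt (suc n) u) (splitAt (suc n) v)
    where
    open Fan F
    open PathWithin path
    g : Fin (suc n) ⊎ Fin k → Fin (size H)
    g (inj₁ i) = vertex i
    g (inj₂ a) = apex a
    distinct : ∀ {x y} → Adj H x y → x ≢ y
    distinct a refl = irrefl H a
    g-injective : ∀ s t → g s ≡ g t → s ≡ t
    g-injective (inj₁ i) (inj₁ j) e = cong inj₁ (injective e)
    g-injective (inj₁ i) (inj₂ b) e = ⊥-elim (distinct (path-apex-adjacent i b) e)
    g-injective (inj₂ a) (inj₁ j) e = ⊥-elim (distinct (path-apex-adjacent j a) (sym e))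
    g-injective (inj₂ a) (inj₂ b) e with a Fin.≟ b
    ... | yes a≡b = cong inj₂ a≡b
    ... | no  a≢b = ⊥-elim (distinct (apex-clique a b a≢b) e)
    g∘splitAt-injective : Injective _≡_ _≡_ (λ u → g (splitAt (suc n) u))
    g∘splitAt-injective {u} {v} e =
      trans (sym (join-splitAt (suc n) k u))
            (trans (cong (join (suc n) k) (g-injective (splitAt (suc n) u) (splitAt (suc n) v) e))
                   (join-splitAt (suc n) k v))
    g-adjacent : ∀ s t → JoinAdj′ (P (suc n)) (K k) s t → Adj H (g s) (g t)
    g-adjacent (inj₁ i) (inj₁ j) (inj₁ e) = adjacent i j e
    g-adjacent (inj₁ i) (inj₁ j) (inj₂ e) = symm H (adjacent j i e)
    g-adjacent (inj₁ i) (inj₂ a) _        = path-apex-adjacent i a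
    g-adjacent (inj₂ a) (inj₁ i) _        = symm H (path-apex-adjacent i a)
    g-adjacent (inj₂ a) (inj₂ b) a≢b      = apex-clique a b a≢b

copy-avoiding-or-transversal : ∀ C A {Q : Fin (size (Copies C A)) → Set} → (∀ v → Dec (Q v)) →
  (∃[ i ] ∀ u → ¬ Q (proj₁ (copy C A i) u)) ⊎
  (Σ (Fin (suc C) → Fin (size (Copies C A))) λ f → Injective _≡_ _≡_ f × ∀ i → Q (f i))
copy-avoiding-or-transversal C A Q? with all? (λ i → any? (λ u → Q? (proj₁ (copy C A i) u)))
... | yes hit = inj₂ ( (λ i → proj₁ (copy C A i) (proj₁ (hit i)))
                     , (λ {i} {j} → copies-disjoint C A (proj₁ (hit i)) (proj₁ (hit j)))
                     , (λ i → proj₂ (hit i)) )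
... | no ¬hit = let i , missed = ¬∀⟶∃¬ _ _ (λ i → any? (λ u → Q? (proj₁ (copy C A i) u))) ¬hit in
                inj₁ (i , λ u q → missed (u , q))

ClosedNeighbour : (G : Graph) → Fin (size G) → Fin (size G) → Set
ClosedNeighbour G α v = v ≡ α ⊎ Adj G α v

toℕ-mod : ∀ {t n} .{{_ : NonZero n}} → t < n → toℕ (t mod n) ≡ t
toℕ-mod t<n = trans (toℕ-fromℕ< _) (m<n⇒m%n≡m t<n)

IsWeakHomomorphism : (G H : Graph) → (Fin (size G) → Fin (size H)) → Set
IsWeakHomomorphism G H f = ∀ {u v} → Adj G u v → f u ≡ f v ⊎ Adj H (f u) (f v)

weakHomomorphism-∘ : ∀ {F G H f g} → IsWeakHomomorphism F G f → IsWeakHomomorphism G H g →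
                     IsWeakHomomorphism F H (λ u → g (f u))
weakHomomorphism-∘ {g = g} f-weak g-weak a with f-weak a
... | inj₁ e = inj₁ (cong g e)
... | inj₂ b = g-weak b

weakHomomorphism-closedNeighbour : ∀ {G H f} → IsWeakHomomorphism G H f →
  ∀ {α v} → ClosedNeighbour G α v → ClosedNeighbour H (f α) (f v)
weakHomomorphism-closedNeighbour f-weak (inj₁ refl) = inj₁ refl
weakHomomorphism-closedNeighbour f-weak (inj₂ a) with f-weak a
... | inj₁ e = inj₁ (sym e)
... | inj₂ b = inj₂ b

apex-closedNeighbour : ∀ {A T} (φ : (K 1 ⊕ A) ⊆ᵍ T) u → ClosedNeighbour T (proj₁ φ zero) (proj₁ φ u)
apex-closedNeighbour φ zero    = inj₁ refl
apex-closedNeighbour φ (suc u) = inj₂ (proj₂ (proj₂ φ) {zero} {suc u} _)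

module _ (H T : Graph) (π : Fin (size T) → Fin (size H))
         (π-weak : IsWeakHomomorphism T H π)
         (c : ℕ) (α : Fin (size T))
         (sparse-fibres : ∀ x (f : Fin (suc c) → Fin (size T)) → Injective _≡_ _≡_ f →
                          (∀ i → ClosedNeighbour T α (f i)) → ¬ (∀ i → π (f i) ≡ x))
         where

  -- If the root of Tower N c (suc j) lies over h, one of its suc c subtowers avoids the fibre
  -- over h (these vertices all lie near α), so that subtower lies over neighbours of h.
  towerFan : ∀ n N j → walkLength c n ≤ suc (suc N) → (S : Fin (size H) → Set) (φ : Tower N c j ⊆ᵍ T) →
             (∀ u → ClosedNeighbour T α (proj₁ φ u)) → (∀ u → S (π (proj₁ φ u))) → Fan H S n j
  towerFan n N zero len S (e , e-inj , e-adj) near inS =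
    pathFan H (proj₁ (walk⇒path H c n S w (suc (suc N)) len (λ t _ → inS _) lazy visits))
    where
    w : ℕ → Fin (size H)
    w t = π (e (t mod suc (suc N)))
    lazy : IsLazyWalk H w (suc (suc N))
    lazy t t+1<N = π-weak (e-adj (inj₁ (trans (cong suc (toℕ-mod (ℕ.<-trans (ℕ.n<1+n t) t+1<N)))
                                              (sym (toℕ-mod t+1<N)))))
    visits : VisitsAtMost H c w (suc (suc N))
    visits x ts ts-inj ts<N = sparse-fibres x (λ i → e (ts i mod suc (suc N)))
      (λ {i} {j} eq → ts-inj (trans (sym (toℕ-mod (ts<N i))) (trans (cong toℕ (e-inj eq)) (toℕ-mod (ts<N j)))))
      (λ i → near _)
  towerFan n N (suc j) len S φ@(e , e-inj , e-adj) near inS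
    with copy-avoiding-or-transversal c (Tower N c j) (λ v → π (e (suc v)) Fin.≟ π (e zero))
  ... | inj₂ (f , f-inj , hits) =
    ⊥-elim (sparse-fibres (π (e zero)) (λ i → e (suc (f i)))
                          (λ eq → f-inj (Finₚ.suc-injective (e-inj eq))) (λ i → near _) hits)
  ... | inj₁ (i , avoids) = addApex H h (inS zero) (towerFan n N j len S′ φ′ (λ u → near _) inS′)
    where
    h = π (e zero)
    S′ : Fin (size H) → Set
    S′ y = S y × Adj H h y
    φ′ : Tower N c j ⊆ᵍ T
    φ′ = ⊆ᵍ-trans {Tower N c j} {Tower N c (suc j)} {T}
           (⊆ᵍ-trans {Tower N c j} {Copies c (Tower N c j)} {Tower N c (suc j)}
                     (copy c (Tower N c j) i) (⊆ᵍ-⊕ʳ {K 1})) φ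
    inS′ : ∀ u → S′ (π (proj₁ φ′ u))
    inS′ u with π-weak (e-adj {zero} {suc (proj₁ (copy c (Tower N c j) i) u)} _)
    ... | inj₁ same = ⊥-elim (avoids u (sym same))
    ... | inj₂ a    = inS _ , a

module _ (A B : Graph) where

  ⊠-proj₁ : Fin (size (A ⊠ B)) → Fin (size A)
  ⊠-proj₁ u = proj₁ (remQuot (size B) u)

  ⊠-proj₂ : Fin (size (A ⊠ B)) → Fin (size B)
  ⊠-proj₂ u = proj₂ (remQuot {size A} (size B) u)

  ⊠-proj₁-weakHomomorphism : IsWeakHomomorphism (A ⊠ B) A ⊠-proj₁
  ⊠-proj₁-weakHomomorphism (_ , a , _) = a

  ⊠-proj₂-weakHomomorphism : IsWeakHomomorphism (A ⊠ B) B ⊠-proj₂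
  ⊠-proj₂-weakHomomorphism (_ , _ , b) = b

  ⊠-proj-injective : ∀ {u v} → ⊠-proj₁ u ≡ ⊠-proj₁ v → ⊠-proj₂ u ≡ ⊠-proj₂ v → u ≡ v
  ⊠-proj-injective {u} {v} e₁ e₂ =
    trans (sym (Finₚ.combine-remQuot {size A} (size B) u))
          (trans (cong₂ combine e₁ e₂) (Finₚ.combine-remQuot {size A} (size B) v))

pathNeighbourCode : ∀ {n} {q v : Fin n} → ClosedNeighbour (P n) q v → Fin 3
pathNeighbourCode (inj₁ _)        = zero
pathNeighbourCode (inj₂ (inj₁ _)) = suc zero
pathNeighbourCode (inj₂ (inj₂ _)) = suc (suc zero)

pathNeighbourCode-injective : ∀ {n} {q v v′ : Fin n} (p : ClosedNeighbour (P n) q v) (p′ : ClosedNeighbour (P n) q v′) →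
                              pathNeighbourCode p ≡ pathNeighbourCode p′ → v ≡ v′
pathNeighbourCode-injective (inj₁ refl)      (inj₁ refl)       _ = refl
pathNeighbourCode-injective (inj₂ (inj₁ e))  (inj₂ (inj₁ e′))  _ = toℕ-injective (trans (sym e) e′)
pathNeighbourCode-injective (inj₂ (inj₂ e))  (inj₂ (inj₂ e′))  _ = toℕ-injective (ℕ.suc-injective (trans e (sym e′)))
pathNeighbourCode-injective (inj₁ _)         (inj₂ (inj₁ _))  ()
pathNeighbourCode-injective (inj₁ _)         (inj₂ (inj₂ _))  ()
pathNeighbourCode-injective (inj₂ (inj₁ _))  (inj₁ _)         ()
pathNeighbourCode-injective (inj₂ (inj₁ _))  (inj₂ (inj₂ _))  ()
pathNeighbourCode-injective (inj₂ (inj₂ _))  (inj₁ _)         ()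
pathNeighbourCode-injective (inj₂ (inj₂ _))  (inj₂ (inj₁ _))  ()

module _ (H : Graph) (m ℓ : ℕ) where

  πH : Fin (size (H ⊠ P (suc m) ⊠ K ℓ)) → Fin (size H)
  πH u = ⊠-proj₁ H (P (suc m)) (⊠-proj₁ (H ⊠ P (suc m)) (K ℓ) u)

  πH-weakHomomorphism : IsWeakHomomorphism (H ⊠ P (suc m) ⊠ K ℓ) H πH
  πH-weakHomomorphism = weakHomomorphism-∘ {H ⊠ P (suc m) ⊠ K ℓ} {H ⊠ P (suc m)} {H}
    (⊠-proj₁-weakHomomorphism (H ⊠ P (suc m)) (K ℓ)) (⊠-proj₁-weakHomomorphism H (P (suc m)))

  -- Near α, a vertex over x is determined by its offset along P (one of three) and its K ℓ coordinate.
  strongProduct-sparse-fibres : ∀ α x (f : Fin (suc (3 * ℓ)) → Fin (size (H ⊠ P (suc m) ⊠ K ℓ))) → Injective _≡_ _≡_ f →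
    (∀ i → ClosedNeighbour (H ⊠ P (suc m) ⊠ K ℓ) α (f i)) → ¬ (∀ i → πH (f i) ≡ x)
  strongProduct-sparse-fibres α x f f-inj near over-x = Finₚ.<⇒≢ i<j (f-inj (⊠-proj-injective HP (K ℓ) same-HP same-K))
    where
    HP = H ⊠ P (suc m)
    πP : Fin (size (HP ⊠ K ℓ)) → Fin (suc m)
    πP u = ⊠-proj₂ H (P (suc m)) (⊠-proj₁ HP (K ℓ) u)
    offset : ∀ i → ClosedNeighbour (P (suc m)) (πP α) (πP (f i))
    offset i = weakHomomorphism-closedNeighbour {HP ⊠ K ℓ} {P (suc m)}
      (weakHomomorphism-∘ {HP ⊠ K ℓ} {HP} {P (suc m)}
        (⊠-proj₁-weakHomomorphism HP (K ℓ)) (⊠-proj₂-weakHomomorphism H (P (suc m))))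
      (near i)
    code : Fin (suc (3 * ℓ)) → Fin (3 * ℓ)
    code i = combine (pathNeighbourCode (offset i)) (⊠-proj₂ HP (K ℓ) (f i))
    collision = Finₚ.pigeonhole (ℕ.n<1+n (3 * ℓ)) code
    i = proj₁ collision
    j = proj₁ (proj₂ collision)
    i<j = proj₁ (proj₂ (proj₂ collision))
    same-codes = Finₚ.combine-injective _ _ _ _ (proj₂ (proj₂ (proj₂ collision)))
    same-HP : ⊠-proj₁ HP (K ℓ) (f i) ≡ ⊠-proj₁ HP (K ℓ) (f j)
    same-HP = ⊠-proj-injective H (P (suc m)) (trans (over-x i) (sym (over-x j)))
                (pathNeighbourCode-injective (offset i) (offset j) (proj₁ same-codes))
    same-K : ⊠-proj₂ HP (K ℓ) (f i) ≡ ⊠-proj₂ HP (K ℓ) (f j)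
    same-K = proj₂ same-codes

proposition10 : (k ℓ n : ℕ) → 1 ≤ k → 1 ≤ ℓ → 1 ≤ n →
    Σ Graph λ G → PathwidthAtMost G (suc k) ×
      ((H : Graph) (m : ℕ) → G ⊆ᵍ (H ⊠ P (suc m) ⊠ K ℓ) → (P n ⊕ K k) ⊆ᵍ H)
proposition10 (suc k) ℓ (suc n) _ _ _ =
  Tower N c (suc k) , toPathDecomposition (towerDecomposition N c (suc k)) , embedding
  where
  c = 3 * ℓ
  N = walkLength c n
  embedding : (H : Graph) (m : ℕ) → Tower N c (suc k) ⊆ᵍ (H ⊠ P (suc m) ⊠ K ℓ) → (P (suc n) ⊕ K (suc k)) ⊆ᵍ H
  embedding H m φ = fan⇒⊆ᵍ H (towerFan H (H ⊠ P (suc m) ⊠ K ℓ) (πH H m ℓ) (πH-weakHomomorphism H m ℓ) c α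
                                (strongProduct-sparse-fibres H m ℓ α)
                                n N (suc k) (ℕ.≤-trans (ℕ.n≤1+n N) (ℕ.n≤1+n (suc N))) (λ _ → ⊤) φ
                                (apex-closedNeighbour {T = H ⊠ P (suc m) ⊠ K ℓ} φ) (λ _ → tt))
    where
    α = proj₁ φ zero
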